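{- Let $\mathbf u$ be a recurrent aperiodic infinite word, $n\in\mathbb N$, $w$ a factor of $\mathbf u$ of length $n$, and $m=nr\mathcal{C}_\mathbf u(n)$. Let $h\in\mathbb N$ be such that the factors $f_n(h),\dots,f_n(h+m-1)$ are pairwise distinct, $f_n(h-1)$ is right special and belongs to $L=\{f_n(h),\dots,f_n(h+m-1)\}$, and $f_n(h+m)$ is left special and belongs to $L$. Assume $nr\mathcal{C}_\mathbf u(n)=\mathcal{C}_\mathbf u(n)$. Then: (1) if $w\neq f_n(h-1)$, then $N_+(w)$ contains at least $\#N_+(w)-1$ left special factors; (2) if $w\neq f_n(h+m)$, then $N_-(w)$ contains at least $\#N_-(w)-1$ right special factors.
   Context: For an infinite word $\mathbf u=u_0u_1\cdots$, $f_n(i)=u_i\cdots u_{i+n-1}$; $\mathcal{L}_\mathbf u(n)$ is the set of factors of length $n$ and $\mathcal{C}_\mathbf u(n)=\#\mathcal{L}_\mathbf u(n)$. Recurrent: every factor occurs at least twice; aperiodic: not eventually periodic. A factor $w$ is right (resp. left) special if $wa,wb$ (resp. $aw,bw$) are factors for two distinct letters $a,b$. For $w\in\mathcal{L}_\mathbf u(n)$, $N_+(w)$ is the set of $v\in\mathcal{L}_\mathbf u(n)$ such that some factor of length $n+1$ has prefix $w$ and suffix $v$, and $N_-(w)$ is the set of $v\in\mathcal{L}_\mathbf u(n)$ such that some factor of length $n+1$ has prefix $v$ and suffix $w$. The non-repetitive complexity is $nr\mathcal{C}_\mathbf u(n)=\max\{m\in\mathbb N: \exists k \text{ such that } f_n(i)\neq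 f_n(j) \text{ for all } k\le i<j\le k+m-1\}$. (Such an $h$ always exists.) -}

module Defs where

open import Data.Nat using (ℕ; zero; suc; _+_; _∸_; _≤_; _<_)
open import Data.Fin using (Fin; toℕ)
open import Data.Vec using (Vec; tabulate; _∷_; _∷ʳ_; init; tail)
open import Data.List using (List; length)
open import Data.List.Membership.Propositional using (_∈_)
open import Data.List.Relation.Unary.Unique.Propositional using (Unique)
open import Data.List.Relation.Unary.All using (All)
open import Data.Product using (Σ; ∃; ∃-syntax; _×_)
open import Relation.Binary.PropositionalEquality using (_≡_; _≢_)
open import Relation.Nullary using (¬_)
open import Function.Bundles using (_⇔_)

Word : ℕ → Set
Word k = ℕ → Fin k

module _ {k : ℕ} (u : Word k) where

  f : (n i : ℕ) → Vec (Fin k) n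
  f n i = tabulate (λ j → u (i + toℕ j))

  Factor : (n : ℕ) → Vec (Fin k) n → Set
  Factor n w = ∃[ i ] f n i ≡ w

  Recurrent : Set
  Recurrent = ∀ n i → ∃[ j ] (j ≢ i × f n j ≡ f n i)

  EventuallyPeriodic : Set
  EventuallyPeriodic = ∃[ p ] ∃[ N ] (1 ≤ p × (∀ i → N ≤ i → u (i + p) ≡ u i))

  Aperiodic : Set
  Aperiodic = ¬ EventuallyPeriodic

  RightSpecial : (n : ℕ) → Vec (Fin k) n → Set
  RightSpecial n w = ∃[ a ] ∃[ b ] (a ≢ b × Factor (suc n) (w ∷ʳ a) × Factor (suc n) (w ∷ʳ b))

  LeftSpecial : (n : ℕ) → Vec (Fin k) n → Set
  LeftSpecial n w = ∃[ a ] ∃[ b ] (a ≢ b × Factor (suc n) (a ∷ w) × Factor (suc n) (b ∷ w))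

  Nplus : (n : ℕ) → Vec (Fin k) n → Vec (Fin k) n → Set
  Nplus n w v = Factor n v × (∃[ x ] (Factor (suc n) x × init x ≡ w × tail x ≡ v))

  Nminus : (n : ℕ) → Vec (Fin k) n → Vec (Fin k) n → Set
  Nminus n w v = Factor n v × (∃[ x ] (Factor (suc n) x × init x ≡ v × tail x ≡ w))

  PairwiseDistinctFrom : (n k₀ m : ℕ) → Set
  PairwiseDistinctFrom n k₀ m =
    ∀ i j → k₀ ≤ i → i < j → j < k₀ + m → f n i ≢ f n j

  IsNrC : (n m : ℕ) → Set
  IsNrC n m = (∃[ k₀ ] PairwiseDistinctFrom n k₀ m)
            × (∀ m' k₀ → PairwiseDistinctFrom n k₀ m' → m' ≤ m)

  InWindow : (n h m : ℕ) → Vec (Fin k) n → Set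
  InWindow n h m w = ∃[ i ] (h ≤ i × i < h + m × f n i ≡ w)

HasCard : {A : Set} → (A → Set) → ℕ → Set
HasCard {A} P c = ∃[ xs ] (Unique xs × (∀ (x : A) → (x ∈ xs) ⇔ P x) × length xs ≡ c)

ContainsAtLeast : {A : Set} → (A → Set) → (A → Set) → ℕ → Set
ContainsAtLeast {A} P Q c =
  ∃[ xs ] (Unique xs × All (λ x → P x × Q x) xs × c ≤ length xs)

module Submission where

-- Since nrC_u(n) = C_u(n) = m, the m pairwise distinct
-- factors f_n(h), …, f_n(h+m-1) are ALL the factors of length n (pigeonhole),
-- so w = f_n(i) for a unique position i of this window.  Take v ∈ N_+(w),
-- i.e. w = f_n(p) and v = f_n(p+1) for some p, and write v = f_n(j+1) with
-- j+1 in the window.  If u_p ≠ u_j then v is left special; otherwise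
-- f_{n+1}(p) = f_{n+1}(j), hence w = f_n(j), and either j = h-1 (excluded by
-- w ≠ f_n(h-1)) or j lies in the window and j = i, i.e. v = f_n(i+1).  So all
-- elements of N_+(w) but possibly f_n(i+1) are left special; part (2) is the
-- mirror image with right extensions.

open import Defs
open import Data.Nat using (ℕ; zero; suc; _+_; _∸_; _≤_; _<_; z≤n; s≤s)
open import Data.Nat.Properties
  using (<-cmp; +-identityʳ; +-suc; +-cancelˡ-≡; m≤n⇒m<n∨m≡n; m≤m+n; +-monoʳ-<;
         n≤1+n; ≤-reflexive; ≤-trans; <-trans; n<1+n; ∸-monoˡ-≤)
open import Data.Fin as Fin using (Fin; toℕ; inject₁; fromℕ)
open import Data.Fin.Properties as Fin using (toℕ-inject₁; toℕ-fromℕ; toℕ<n; toℕ-injective; pigeonhole)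
open import Data.Vec using (Vec; tabulate; _∷_; _∷ʳ_; init; tail)
open import Data.Vec.Properties using (tabulate-cong; init-∷ʳ; ≡-dec)
open import Data.List as List using (List; length; filter)
open import Data.List.Properties using (filter-all)
open import Data.List.Membership.Propositional using (_∈_)
open import Data.List.Relation.Unary.Unique.Propositional using (Unique)
open import Data.List.Relation.Unary.Unique.Propositional.Properties as Unique using ()
open import Data.List.Relation.Unary.AllPairs as AllPairs using ()
open import Data.List.Relation.Unary.All as All using ()
open import Data.List.Relation.Unary.All.Properties as AllP using (all-filter)
open import Data.List.Relation.Unary.Any as Any using ()
open import Data.List.Relation.Unary.Any.Properties using (lookup-index)
open import Data.Product using (∃-syntax; _×_; _,_; proj₁)
open import Data.Sum using (_⊎_; inj₁; inj₂)
open import Data.Empty using (⊥; ⊥-elim)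
open import Relation.Nullary using (yes; no; ¬?)
open import Relation.Unary using (Decidable)
open import Relation.Binary.Definitions using (DecidableEquality; tri<; tri≈; tri>)
open import Relation.Binary.PropositionalEquality
  using (_≡_; _≢_; refl; sym; trans; cong; cong₂; ≢-sym; module ≡-Reasoning)
open import Function.Bundles using (Equivalence)

-- If P has exactly m elements and g is an injective family of m elements of
-- P, then every element of P is a value of g (pigeonhole on g extended by a).
injective-family-exhausts : {A : Set} {P : A → Set} {m : ℕ} → HasCard P m →
  (g : Fin m → A) → (∀ i → P (g i)) → (∀ i j → g i ≡ g j → i ≡ j) →
  ∀ a → P a → ∃[ i ] g i ≡ a
injective-family-exhausts {A} {P} (xs , _ , iff , refl) g Pg g-inj a Pa =
  conclude (pigeonhole (n<1+n (length xs)) position)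
  where
  g⁺ : Fin (suc (length xs)) → A
  g⁺ Fin.zero    = a
  g⁺ (Fin.suc i) = g i

  member : ∀ i → g⁺ i ∈ xs
  member Fin.zero    = Equivalence.from (iff a) Pa
  member (Fin.suc i) = Equivalence.from (iff (g i)) (Pg i)

  position : Fin (suc (length xs)) → Fin (length xs)
  position i = Any.index (member i)

  same-position : ∀ i j → position i ≡ position j → g⁺ i ≡ g⁺ j
  same-position i j eq =
    trans (lookup-index (member i))
      (trans (cong (List.lookup xs) eq) (sym (lookup-index (member j))))

  conclude : (∃[ i ] ∃[ j ] (i Fin.< j × position i ≡ position j)) → ∃[ i ] g i ≡ a
  conclude (Fin.zero  , Fin.suc j , _ , eq) = j , sym (same-position Fin.zero (Fin.suc j) eq)
  conclude (Fin.suc i , Fin.suc j , s≤s i<j , eq) =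
    ⊥-elim (Fin.<-irrefl (g-inj i j (same-position (Fin.suc i) (Fin.suc j) eq)) i<j)

module _ {A : Set} (_≟_ : DecidableEquality A) where

  length-without : ∀ x {xs : List A} → Unique xs →
    length xs ≤ suc (length (filter (λ y → ¬? (y ≟ x)) xs))
  length-without x AllPairs.[] = z≤n
  length-without x {y List.∷ ys} (y∉ys AllPairs.∷ uniq) with y ≟ x
  ... | yes refl = s≤s (≤-reflexive (cong length
                     (sym (filter-all (λ z → ¬? (z ≟ x)) (All.map ≢-sym y∉ys)))))
  ... | no _ = s≤s (length-without x uniq)

  all-but-one : {P Q : A → Set} (x : A) {c : ℕ} → HasCard P c →
    (∀ a → P a → a ≢ x → Q a) → ContainsAtLeast P Q (c ∸ 1)
  all-but-one x (xs , uniq , iff , refl) P∧≢⇒Q =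
    filter keep? xs , Unique.filter⁺ keep? uniq ,
    All.zipWith (λ { (∈xs , ≢x) → let Pa = Equivalence.to (iff _) ∈xs in Pa , P∧≢⇒Q _ Pa ≢x })
      (AllP.filter⁺ keep? (All.tabulate (λ ∈xs → ∈xs)) , all-filter keep? xs) ,
    ∸-monoˡ-≤ 1 (length-without x uniq)
    where
    keep? : Decidable (λ y → y ≢ x)
    keep? y = ¬? (y ≟ x)

tabulate-∷ʳ : {A : Set} (n : ℕ) (g : Fin (suc n) → A) →
  tabulate g ≡ tabulate (λ j → g (inject₁ j)) ∷ʳ g (fromℕ n)
tabulate-∷ʳ zero    g = refl
tabulate-∷ʳ (suc n) g = cong (g Fin.zero ∷_) (tabulate-∷ʳ n (λ j → g (Fin.suc j)))

module _ {k : ℕ} (u : Word k) where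

  f-∷ : ∀ n p → f u (suc n) p ≡ u p ∷ f u n (suc p)
  f-∷ n p = cong₂ _∷_ (cong u (+-identityʳ p)) (tabulate-cong (λ j → cong u (+-suc p (toℕ j))))

  f-∷ʳ : ∀ n p → f u (suc n) p ≡ f u n p ∷ʳ u (p + n)
  f-∷ʳ n p = trans (tabulate-∷ʳ n (λ j → u (p + toℕ j)))
    (cong₂ _∷ʳ_ (tabulate-cong (λ j → cong (λ t → u (p + t)) (toℕ-inject₁ j)))
                (cong (λ t → u (p + t)) (toℕ-fromℕ n)))

  init-f : ∀ n p → init (f u (suc n) p) ≡ f u n p
  init-f n p = trans (cong init (f-∷ʳ n p)) (init-∷ʳ _ (f u n p))

  tail-f : ∀ n p → tail (f u (suc n) p) ≡ f u n (suc p)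
  tail-f n p = cong tail (f-∷ n p)

  Nplus-occurrence : ∀ {n w v} → Nplus u n w v → ∃[ p ] (f u n p ≡ w × f u n (suc p) ≡ v)
  Nplus-occurrence {n} (_ , _ , (p , refl) , init≡w , tail≡v) =
    p , trans (sym (init-f n p)) init≡w , trans (sym (tail-f n p)) tail≡v

  Nminus-occurrence : ∀ {n w v} → Nminus u n w v → ∃[ p ] (f u n p ≡ v × f u n (suc p) ≡ w)
  Nminus-occurrence {n} (_ , _ , (p , refl) , init≡v , tail≡w) =
    p , trans (sym (init-f n p)) init≡v , trans (sym (tail-f n p)) tail≡w

  left-extensions : ∀ {n v} p q → f u n (suc p) ≡ v → f u n (suc q) ≡ v →
    LeftSpecial u n v ⊎ f u n p ≡ f u n q
  left-extensions {n} p q refl fsq≡v with u p Fin.≟ u q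
  ... | no up≢uq = inj₁ (u p , u q , up≢uq , (p , f-∷ n p) , (q , trans (f-∷ n q) (cong (u q ∷_) fsq≡v)))
  ... | yes up≡uq = inj₂ (begin
    f u n p                    ≡⟨ sym (init-f n p) ⟩
    init (f u (suc n) p)       ≡⟨ cong init (f-∷ n p) ⟩
    init (u p ∷ f u n (suc p)) ≡⟨ cong init (cong₂ _∷_ up≡uq (sym fsq≡v)) ⟩
    init (u q ∷ f u n (suc q)) ≡⟨ cong init (sym (f-∷ n q)) ⟩
    init (f u (suc n) q)       ≡⟨ init-f n q ⟩
    f u n q                    ∎)
    where open ≡-Reasoning

  right-extensions : ∀ {n v} p q → f u n p ≡ v → f u n q ≡ v →
    RightSpecial u n v ⊎ f u n (suc p) ≡ f u n (suc q)
  right-extensions {n} p q refl fq≡v with u (p + n) Fin.≟ u (q + n)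
  ... | no a≢b = inj₁ (u (p + n) , u (q + n) , a≢b , (p , f-∷ʳ n p) ,
                       (q , trans (f-∷ʳ n q) (cong (_∷ʳ u (q + n)) fq≡v)))
  ... | yes a≡b = inj₂ (begin
    f u n (suc p)                ≡⟨ sym (tail-f n p) ⟩
    tail (f u (suc n) p)         ≡⟨ cong tail (f-∷ʳ n p) ⟩
    tail (f u n p ∷ʳ u (p + n))  ≡⟨ cong tail (cong₂ _∷ʳ_ (sym fq≡v) a≡b) ⟩
    tail (f u n q ∷ʳ u (q + n))  ≡⟨ cong tail (sym (f-∷ʳ n q)) ⟩
    tail (f u (suc n) q)         ≡⟨ tail-f n q ⟩
    f u n (suc q)                ∎)
    where open ≡-Reasoning

  module Window (n h m : ℕ) (distinct : PairwiseDistinctFrom u n h m) where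

    window-injective : ∀ {i j} → h ≤ i → i < h + m → h ≤ j → j < h + m →
      f u n i ≡ f u n j → i ≡ j
    window-injective {i} {j} h≤i i<hm h≤j j<hm fi≡fj with <-cmp i j
    ... | tri< i<j _ _ = ⊥-elim (distinct i j h≤i i<j j<hm fi≡fj)
    ... | tri≈ _ i≡j _ = i≡j
    ... | tri> _ _ j<i = ⊥-elim (distinct j i h≤j j<i i<hm (sym fi≡fj))

    Exhaustive : Set
    Exhaustive = ∀ v → Factor u n v → InWindow u n h m v

    window : Fin m → Vec (Fin k) n
    window i = f u n (h + toℕ i)

    window-family-injective : ∀ i j → window i ≡ window j → i ≡ j
    window-family-injective i j eq = toℕ-injective (+-cancelˡ-≡ h (toℕ i) (toℕ j)
      (window-injective (m≤m+n h (toℕ i)) (+-monoʳ-< h (toℕ<n i))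
                        (m≤m+n h (toℕ j)) (+-monoʳ-< h (toℕ<n j)) eq))

    window-exhaustive : HasCard (Factor u n) m → Exhaustive
    window-exhaustive card v fv
      with i , fi≡v ← injective-family-exhausts card window (λ i → h + toℕ i , refl)
                        window-family-injective v fv
      = h + toℕ i , m≤m+n h (toℕ i) , +-monoʳ-< h (toℕ<n i) , fi≡v

    successors-leftSpecial : 1 ≤ h → Exhaustive → ∀ {i} → h ≤ i → i < h + m →
      f u n i ≢ f u n (h ∸ 1) →
      ∀ v → Nplus u n (f u n i) v → v ≢ f u n (suc i) → LeftSpecial u n v
    successors-leftSpecial 1≤h exhaustive {i} h≤i i<hm fi≢ v v∈N₊ v≢
      with p , fp≡fi , fsp≡v ← Nplus-occurrence v∈N₊
      with exhaustive v (proj₁ v∈N₊)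
    ... | zero , h≤0 , _ with () ← ≤-trans 1≤h h≤0
    ... | suc j , h≤sj , sj<hm , fsj≡v with left-extensions p j fsp≡v fsj≡v
    ...   | inj₁ special = special
    ...   | inj₂ fp≡fj = ⊥-elim (predecessor (m≤n⇒m<n∨m≡n h≤sj))
      where
      fi≡fj : f u n i ≡ f u n j
      fi≡fj = trans (sym fp≡fi) fp≡fj

      -- j precedes the occurrence j+1 of v: either j = h-1 or j = i.
      predecessor : h < suc j ⊎ h ≡ suc j → ⊥
      predecessor (inj₁ (s≤s h≤j)) = v≢ (trans (sym fsj≡v)
        (cong (λ t → f u n (suc t)) (sym (window-injective h≤i i<hm h≤j (<-trans (n<1+n j) sj<hm) fi≡fj))))
      predecessor (inj₂ h≡sj) = fi≢ (trans fi≡fj (cong (λ t → f u n (t ∸ 1)) (sym h≡sj)))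

    predecessors-rightSpecial : Exhaustive → ∀ {i} → h ≤ i → i < h + m →
      f u n i ≢ f u n (h + m) →
      ∀ v → Nminus u n (f u n i) v → v ≢ f u n (i ∸ 1) → RightSpecial u n v
    predecessors-rightSpecial exhaustive {i} h≤i i<hm fi≢ v v∈N₋ v≢
      with p , fp≡v , fsp≡fi ← Nminus-occurrence v∈N₋
      with j , h≤j , j<hm , fj≡v ← exhaustive v (proj₁ v∈N₋)
      with right-extensions p j fp≡v fj≡v
    ... | inj₁ special = special
    ... | inj₂ fsp≡fsj = ⊥-elim (successor (m≤n⇒m<n∨m≡n j<hm))
      where
      fi≡fsj : f u n i ≡ f u n (suc j)
      fi≡fsj = trans (sym fsp≡fi) fsp≡fsj

      -- j+1 follows the occurrence j of v: either j+1 = h+m or j+1 = i.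
      successor : suc j < h + m ⊎ suc j ≡ h + m → ⊥
      successor (inj₁ sj<hm) = v≢ (trans (sym fj≡v)
        (cong (λ t → f u n (t ∸ 1)) (sym (window-injective h≤i i<hm (≤-trans h≤j (n≤1+n j)) sj<hm fi≡fsj))))
      successor (inj₂ sj≡hm) = fi≢ (trans fi≡fsj (cong (f u n) sj≡hm))

-- Corollary 6.  Only the hypotheses 1 ≤ h, the distinctness of the window and
-- C_u(n) = m are needed: they make the window exhaustive, so w = f_n(i) for
-- some i in the window, and the two neighbour lemmas leave at most one
-- exception in N_+(w), resp. N_-(w).
corollary6 : (k : ℕ) (u : Word k) → Recurrent u → Aperiodic u →
    (n : ℕ) (w : Vec (Fin k) n) → Factor u n w →
    (m : ℕ) → IsNrC u n m →
    (h : ℕ) → 1 ≤ h →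
    PairwiseDistinctFrom u n h m →
    RightSpecial u n (f u n (h ∸ 1)) → InWindow u n h m (f u n (h ∸ 1)) →
    LeftSpecial u n (f u n (h + m)) → InWindow u n h m (f u n (h + m)) →
    HasCard (Factor u n) m →
    ((w ≢ f u n (h ∸ 1) →
        ∀ c → HasCard (Nplus u n w) c → ContainsAtLeast (Nplus u n w) (LeftSpecial u n) (c ∸ 1))
    × (w ≢ f u n (h + m) →
        ∀ c → HasCard (Nminus u n w) c → ContainsAtLeast (Nminus u n w) (RightSpecial u n) (c ∸ 1)))
corollary6 k u _ _ n w w-factor m _ h 1≤h distinct _ _ _ _ card
  with i , h≤i , i<hm , refl ← Window.window-exhaustive u n h m distinct card w w-factor =
  (λ w≢ c card₊ → all-but-one _≟_ (f u n (suc i)) card₊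
                    (successors-leftSpecial 1≤h exhaustive h≤i i<hm w≢)) ,
  (λ w≢ c card₋ → all-but-one _≟_ (f u n (i ∸ 1)) card₋
                    (predecessors-rightSpecial exhaustive h≤i i<hm w≢))
  where
  open Window u n h m distinct

  _≟_ : DecidableEquality (Vec (Fin k) n)
  _≟_ = ≡-dec Fin._≟_

  exhaustive : Exhaustive
  exhaustive = window-exhaustive card
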